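{- Let $m\ge 3$ and $n\ge 3$, and let $f\colon V(K_m)\to V(K_n)$ be any function. Then $$\chi_{\rho}(K_m\otimes_f K_n)\ge mn-2m+2\,.$$ Moreover, if $n\ge m$, then equality holds.
   Context: For graphs $G$ and $H$ and a function $f\colon V(G)\to V(H)$, the Sierpiński product $G\otimes_f H$ is the graph with vertex set $V(G)\times V(H)$ whose edges are: $(g,h)(g,h')$ for every $g\in V(G)$ and every edge $hh'\in E(H)$; and $(g,f(g'))(g',f(g))$ for every edge $gg'\in E(G)$. For a graph $X$, a packing $k$-coloring is a map $c\colon V(X)\to\{1,\dots,k\}$ such that whenever $u\neq v$ and $c(u)=c(v)=\ell$, the shortest-path distance satisfies $d_X(u,v)>\ell$; the packing chromatic number $\chi_\rho(X)$ is the least $k$ for which a packing $k$-coloring exists. $K_m$ denotes the complete graph on $m$ vertices. -}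

module Defs where

open import Level using (0ℓ)
open import Data.Nat using (ℕ; zero; suc; _≤_; _<_)
open import Data.Fin using (Fin; toℕ)
open import Data.Product using (Σ; _×_; _,_; ∃)
open import Data.Sum using (_⊎_)
open import Relation.Binary.PropositionalEquality using (_≡_; _≢_)
open import Relation.Nullary using (¬_)

record Graph : Set₁ where
  field
    V : Set
    E : V → V → Set
open Graph public

K : ℕ → Graph
K m = record { V = Fin m ; E = λ a b → a ≢ b }

Sierpinski : (G H : Graph) → (V G → V H) → Graph
Sierpinski G H f = record
  { V = V G × V H
  ; E = λ { (g , h) (g' , h') →
            (g ≡ g' × E H h h')
            ⊎ (E G g g' × (h ≡ f g' × h' ≡ f g)) } }

data Walk (X : Graph) : V X → V X → ℕ → Set where
  here : ∀ {u} → Walk X u u zero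
  step : ∀ {u w v k} → E X u w → Walk X w v k → Walk X u v (suc k)

DistLe : (X : Graph) → V X → V X → ℕ → Set
DistLe X u v ℓ = Σ ℕ λ k → k ≤ ℓ × Walk X u v k

-- Packing k-coloring: colors are Fin k, color i stands for toℕ i + 1 ∈ {1..k}.
-- If u ≠ v get the same color ℓ then d(u,v) > ℓ, i.e. not d(u,v) ≤ ℓ.
IsPackingColoring : (X : Graph) (k : ℕ) → (V X → Fin k) → Set
IsPackingColoring X k c =
  ∀ u v → u ≢ v → c u ≡ c v → ¬ DistLe X u v (suc (toℕ (c u)))

HasPackingColoring : Graph → ℕ → Set
HasPackingColoring X k = Σ (V X → Fin k) (IsPackingColoring X k)

IsPackingChromaticNumber : Graph → ℕ → Set
IsPackingChromaticNumber X N =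
  HasPackingColoring X N × (∀ k → HasPackingColoring X k → N ≤ k)

{-# OPTIONS --safe #-}
-- The product has diameter at most 3 and each copy of K_n is a clique, so in a packing colouring
-- colours 1 and 2 occur at most once per copy and every other colour at most once overall:
-- mn ≤ 2m + (k − 2).
--
-- Call (g , x) secluded if it has no neighbour outside copy g, i.e.
-- x ∉ f(V(K_m) ∖ {g}); as f takes at most m − 1 < n values there, every copy has one, and two
-- secluded vertices in different copies are at distance at least 3: colour one per copy with 2.
-- For colour 1 take another secluded vertex of copy g if there is one, else (g , f (σ g)).  An
-- edge between two colour-1 vertices forces neither to be secluded and gives f(σ g) = f(g') or
-- f(σ g') = f(g), a collision of f away from g or g'; but a collision leaves a value free for one
-- more secluded vertex there.  The remaining m(n − 2) vertices all get distinct colours.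
module Submission where

open import Defs
open import Data.Nat using (ℕ; zero; suc; _≤_; _<_; _+_; _*_; _∸_; z≤n; s≤s)
open import Data.Nat.Properties using (≤-trans; m≤n+m; m+n∸m≡n; +-monoˡ-≤; ∸-monoˡ-≤; *-distribˡ-+; <⇒≱; module ≤-Reasoning)
open import Data.Nat.Tactic.RingSolver using (solve-∀)
open import Data.Fin using (Fin; zero; suc; punchIn; punchOut; combine; _≟_)
open import Data.Fin.Properties using (any?; all?; ¬∀⟶∃¬; injective⇒≤; suc-injective; punchIn-punchOut; punchOut-injective; combine-injectiveˡ; combine-injectiveʳ; *↔×; +↔⊎)
open import Data.Vec.Functional using (updateAt)
open import Data.Vec.Functional.Properties using (updateAt-updates; updateAt-minimal)
open import Data.Empty using (⊥; ⊥-elim)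
open import Data.Product using (_×_; _,_; proj₁; proj₂; ∃)
open import Data.Product.Properties using (,-injectiveˡ; ≡-dec)
open import Data.Sum using (_⊎_; inj₁; inj₂)
open import Data.Sum.Properties using (inj₁-injective; inj₂-injective)
open import Data.Sum.Function.Propositional using (_⊎-↔_)
open import Function using (_∘_; const; case_of_)
open import Function.Bundles using (_↣_; mk↣; Injection)
open import Function.Definitions using (Injective)
open import Function.Properties.Inverse using (↔⇒↣; ↔-sym; ↔-refl)
open import Function.Construct.Composition using (_↣-∘_)
open import Relation.Binary.Definitions using (DecidableEquality)
open import Relation.Binary.PropositionalEquality using (_≡_; _≢_; refl; sym; trans; cong; subst)
open import Relation.Nullary using (¬_; Dec; yes; no; ¬?)
open import Relation.Nullary.Decidable using (decidable-stable; _×-dec_; _→-dec_)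

module _ {X : Graph} where

  distLe-refl : ∀ {v} → DistLe X v v 0
  distLe-refl = 0 , z≤n , here

  distLe-edge : ∀ {u v} → E X u v → DistLe X u v 1
  distLe-edge e = 1 , s≤s z≤n , step e here

  distLe-weaken : ∀ {u v i j} → i ≤ j → DistLe X u v i → DistLe X u v j
  distLe-weaken i≤j (l , l≤i , w) = l , ≤-trans l≤i i≤j , w

  distLe-trans : ∀ {u v w i j} → DistLe X u v i → DistLe X v w j → DistLe X u w (i + j)
  distLe-trans (_ , z≤n , here) (l , l≤j , w) = l , ≤-trans l≤j (m≤n+m _ _) , w
  distLe-trans (suc _ , s≤s l≤i , step e w) q with distLe-trans (_ , l≤i , w) q
  ... | l , l≤ , w' = suc l , s≤s l≤ , step e w'

  ¬adjacent⇒¬distLe₁ : ∀ {u v} → u ≢ v → ¬ E X u v → ¬ DistLe X u v 1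
  ¬adjacent⇒¬distLe₁ u≢v _ (_ , _ , here) = u≢v refl
  ¬adjacent⇒¬distLe₁ _ ¬e (_ , _ , step e here) = ¬e e
  ¬adjacent⇒¬distLe₁ _ _ (suc (suc _) , s≤s () , _)

  edge⇒two≤colours : ∀ {u v k} → u ≢ v → E X u v → HasPackingColoring X k → 2 ≤ k
  edge⇒two≤colours {u} {v} {zero} _ _ (c , _) with c u
  ... | ()
  edge⇒two≤colours {u} {v} {suc zero} u≢v e (c , packing) with c u | c v | packing u v u≢v
  ... | zero | zero | apart = ⊥-elim (apart refl (distLe-edge e))
  edge⇒two≤colours {k = suc (suc _)} _ _ _ = s≤s (s≤s z≤n)

module CliqueCover {X : Graph} {C : Set} (copy : V X → C)
         (clique : ∀ {u v} → u ≢ v → copy u ≡ copy v → E X u v)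
         (diameter≤3 : ∀ u v → DistLe X u v 3)
         {k : ℕ} (c : V X → Fin (2 + k)) (packing : IsPackingColoring X (2 + k) c) where

  colourClass : V X → (C × Fin 2) ⊎ Fin k
  colourClass u with c u
  ... | zero = inj₁ (copy u , zero)
  ... | suc zero = inj₁ (copy u , suc zero)
  ... | suc (suc j) = inj₂ j

  colourClass-separates : ∀ {u v} → u ≢ v → colourClass u ≢ colourClass v
  colourClass-separates {u} {v} u≢v with c u | c v | packing u v u≢v
  ... | zero | zero | apart = λ eq →
    apart refl (distLe-edge (clique u≢v (,-injectiveˡ (inj₁-injective eq))))
  ... | suc zero | suc zero | apart = λ eq →
    apart refl (distLe-weaken (s≤s z≤n) (distLe-edge (clique u≢v (,-injectiveˡ (inj₁-injective eq)))))
  ... | suc (suc _) | suc (suc _) | apart = λ eq → case inj₂-injective eq of λ where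
    refl → apart refl (distLe-weaken (s≤s (s≤s (s≤s z≤n))) (diameter≤3 u v))
  ... | zero | suc zero | _ = λ ()
  ... | zero | suc (suc _) | _ = λ ()
  ... | suc zero | zero | _ = λ ()
  ... | suc zero | suc (suc _) | _ = λ ()
  ... | suc (suc _) | zero | _ = λ ()
  ... | suc (suc _) | suc zero | _ = λ ()

  colourClass-injective : DecidableEquality (V X) → Injective _≡_ _≡_ colourClass
  colourClass-injective _≟ᵥ_ {u} {v} eq = decidable-stable (u ≟ᵥ v) (λ u≢v → colourClass-separates u≢v eq)

↣⇒≤ : ∀ {a b c d e} → (Fin a × Fin b) ↣ ((Fin c × Fin d) ⊎ Fin e) → a * b ≤ c * d + e
↣⇒≤ ι = injective⇒≤ (Injection.injective
  (↔⇒↣ (↔-sym +↔⊎) ↣-∘ (↔⇒↣ (↔-sym *↔× ⊎-↔ ↔-refl) ↣-∘ (ι ↣-∘ ↔⇒↣ *↔×))))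

Misses : ∀ {a n} → (Fin a → Fin n) → Fin n → Set
Misses F y = ∀ i → F i ≢ y

<⇒misses : ∀ {a n} → a < n → (F : Fin a → Fin n) → ∃ (Misses F)
<⇒misses {a} {n} a<n F with any? (λ y → all? (λ i → ¬? (F i ≟ y)))
... | yes missed = missed
... | no ¬missed = ⊥-elim (<⇒≱ a<n (injective⇒≤ preimage-injective))
  where
  preimage : ∀ y → ∃ λ i → F i ≡ y
  preimage y with ¬∀⟶∃¬ a (λ i → F i ≢ y) (λ i → ¬? (F i ≟ y)) (λ hit → ¬missed (y , hit))
  ... | i , ¬F≢y = i , decidable-stable (F i ≟ y) ¬F≢y
  preimage-injective : Injective _≡_ _≡_ (proj₁ ∘ preimage)
  preimage-injective {y} {y'} eq =
    trans (sym (proj₂ (preimage y))) (trans (cong F eq) (proj₂ (preimage y')))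

misses-punchIn : ∀ {a n} {F : Fin (suc a) → Fin n} {j y} → Misses (F ∘ punchIn j) y →
                 ∀ i → i ≢ j → F i ≢ y
misses-punchIn {F = F} missed i i≢j Fi≡y =
  missed (punchOut (i≢j ∘ sym)) (trans (cong F (punchIn-punchOut _)) Fi≡y)

collision⇒misses : ∀ {a n} → suc a ≤ n → (F : Fin (suc a) → Fin n) → ∀ {i j} → i ≢ j → F i ≡ F j →
                   ∃ (Misses F)
collision⇒misses a<n F {i} {j} i≢j Fi≡Fj with <⇒misses a<n (F ∘ punchIn j)
... | y , missed = y , misses
  where
  misses : Misses F y
  misses k with k ≟ j
  ... | yes refl = misses-punchIn missed i i≢j ∘ trans Fi≡Fj
  ... | no k≢j = misses-punchIn missed k k≢j

punchOut₂ : ∀ {n} {i j k : Fin (suc (suc n))} → i ≢ j → i ≢ k → j ≢ k → Fin n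
punchOut₂ i≢j i≢k j≢k = punchOut (j≢k ∘ punchOut-injective i≢j i≢k)

punchOut₂-injective : ∀ {n} {i j k l : Fin (suc (suc n))} (i≢j : i ≢ j) (i≢k : i ≢ k) (j≢k : j ≢ k)
                      (i≢l : i ≢ l) (j≢l : j ≢ l) →
                      punchOut₂ i≢j i≢k j≢k ≡ punchOut₂ i≢j i≢l j≢l → k ≡ l
punchOut₂-injective i≢j i≢k j≢k i≢l j≢l =
  punchOut-injective i≢k i≢l
    ∘ punchOut-injective (j≢k ∘ punchOut-injective i≢j i≢k) (j≢l ∘ punchOut-injective i≢j i≢l)

module _ {m n : ℕ} (f : Fin m → Fin n) where
  private
    X : Graph
    X = Sierpinski (K m) (K n) f

  copy-distLe₁ : ∀ g x y → DistLe X (g , x) (g , y) 1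
  copy-distLe₁ g x y with x ≟ y
  ... | yes refl = distLe-weaken z≤n distLe-refl
  ... | no x≢y = distLe-edge (inj₁ (refl , x≢y))

  diameter≤3 : ∀ u v → DistLe X u v 3
  diameter≤3 (g , x) (g' , y) with g ≟ g'
  ... | yes refl = distLe-weaken (s≤s z≤n) (copy-distLe₁ g x y)
  ... | no g≢g' = distLe-trans (copy-distLe₁ g x (f g'))
                    (distLe-trans (distLe-edge (inj₂ (g≢g' , refl , refl))) (copy-distLe₁ g' (f g) y))

  copies-are-cliques : ∀ {u v} → u ≢ v → proj₁ u ≡ proj₁ v → E X u v
  copies-are-cliques {g , x} {.g , y} u≢v refl = inj₁ (refl , u≢v ∘ cong (g ,_))

  packing⇒m*n≤m*2+k : ∀ {k} → HasPackingColoring X (2 + k) → m * n ≤ m * 2 + k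
  packing⇒m*n≤m*2+k (c , packing) = ↣⇒≤ (mk↣ (colourClass-injective (≡-dec _≟_ _≟_)))
    where open CliqueCover proj₁ copies-are-cliques diameter≤3 c packing

  Secluded : Fin m → Fin n → Set
  Secluded g x = ∀ g' → g' ≢ g → f g' ≢ x

  secluded-edgeˡ : ∀ {g x w} → Secluded g x → E X (g , x) w → proj₁ w ≡ g
  secluded-edgeˡ _ (inj₁ (refl , _)) = refl
  secluded-edgeˡ s (inj₂ (g≢g' , x≡fg' , _)) = ⊥-elim (s _ (g≢g' ∘ sym) (sym x≡fg'))

  secluded-edgeʳ : ∀ {g x w} → Secluded g x → E X w (g , x) → proj₁ w ≡ g
  secluded-edgeʳ _ (inj₁ (refl , _)) = refl
  secluded-edgeʳ s (inj₂ (g'≢g , _ , x≡fg')) = ⊥-elim (s _ g'≢g (sym x≡fg'))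

  secluded-apart : ∀ {g x g' y} → Secluded g x → Secluded g' y → g ≢ g' → ¬ DistLe X (g , x) (g' , y) 2
  secluded-apart _ _ g≢g' (_ , _ , here) = g≢g' refl
  secluded-apart s _ g≢g' (_ , _ , step e here) = g≢g' (sym (secluded-edgeˡ s e))
  secluded-apart s s' g≢g' (_ , _ , step e (step e' here)) =
    g≢g' (trans (sym (secluded-edgeˡ s e)) (secluded-edgeʳ s' e'))
  secluded-apart _ _ _ (suc (suc (suc _)) , s≤s (s≤s ()) , _)

module UpperBound {m' n' : ℕ} (f : Fin (3 + m') → Fin (2 + n')) (m≤n : 3 + m' ≤ 2 + n') where
  private
    M N : ℕ
    M = 3 + m'
    N = 2 + n'
    X : Graph
    X = Sierpinski (K M) (K N) f

  -- Any map without fixed points or 2-cycles would do; this is where m ≥ 3 is needed.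
  σ : Fin M → Fin M
  σ zero = suc zero
  σ (suc zero) = suc (suc zero)
  σ (suc (suc _)) = zero

  σ-fixpoint-free : ∀ g → σ g ≢ g
  σ-fixpoint-free zero ()
  σ-fixpoint-free (suc zero) ()
  σ-fixpoint-free (suc (suc _)) ()

  σ²-fixpoint-free : ∀ g → σ (σ g) ≢ g
  σ²-fixpoint-free zero ()
  σ²-fixpoint-free (suc zero) ()
  σ²-fixpoint-free (suc (suc _)) ()

  secluded-exists : ∀ g → ∃ (Secluded f g)
  secluded-exists g with <⇒misses m≤n (f ∘ punchIn g)
  ... | y , missed = y , misses-punchIn missed

  -- (g , v₁ g) and (g , v₂ g) are the vertices of copy g coloured 1 and 2.  They are opaque
  -- because unfolding the searches that define them makes type checking very slow.
  opaque
    v₂ : Fin M → Fin N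
    v₂ g = proj₁ (secluded-exists g)

    v₂-secluded : ∀ g → Secluded f g (v₂ g)
    v₂-secluded g = proj₂ (secluded-exists g)

  Free : Fin M → Fin N → Set
  Free g y = y ≢ v₂ g × Secluded f g y

  free? : ∀ g → Dec (∃ (Free g))
  free? g = any? λ y → ¬? (y ≟ v₂ g) ×-dec all? λ g' → ¬? (g' ≟ g) →-dec ¬? (f g' ≟ y)

  f[_]≔v₂ : Fin M → Fin M → Fin N
  f[ g ]≔v₂ = updateAt f g (const (v₂ g))

  collision⇒free : ∀ {g g₁ g₂} → g₁ ≢ g₂ → g₁ ≢ g → g₂ ≢ g → f g₁ ≡ f g₂ → ∃ (Free g)
  collision⇒free {g} {g₁} {g₂} g₁≢g₂ g₁≢g g₂≢g fg₁≡fg₂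
    with collision⇒misses m≤n f[ g ]≔v₂ g₁≢g₂
           (trans (updateAt-minimal g₁ g f g₁≢g) (trans fg₁≡fg₂ (sym (updateAt-minimal g₂ g f g₂≢g))))
  ... | y , missed = y , (λ y≡v₂ → missed g (trans (updateAt-updates g f) (sym y≡v₂)))
                       , (λ g' g'≢g fg'≡y → missed g' (trans (updateAt-minimal g' g f g'≢g) fg'≡y))

  opaque
    v₁ : Fin M → Fin N
    v₁ g with free? g
    ... | yes (y , _) = y
    ... | no _ = f (σ g)

    v₁≢v₂ : ∀ g → v₁ g ≢ v₂ g
    v₁≢v₂ g with free? g
    ... | yes (_ , y≢v₂ , _) = y≢v₂
    ... | no _ = v₂-secluded g (σ g) (σ-fixpoint-free g)

    v₁-independent : ∀ {g g'} → g ≢ g' → v₁ g ≡ f g' → v₁ g' ≡ f g → ⊥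
    v₁-independent {g} {g'} g≢g' with free? g | free? g'
    ... | yes (_ , _ , secluded) | _ = λ v₁g≡fg' _ → secluded g' (g≢g' ∘ sym) (sym v₁g≡fg')
    ... | no _ | yes (_ , _ , secluded) = λ _ v₁g'≡fg → secluded g g≢g' (sym v₁g'≡fg)
    ... | no ¬free | no ¬free' with g' ≟ σ g
    ...   | no g'≢σg = λ fσg≡fg' _ →
      ¬free (collision⇒free (g'≢σg ∘ sym) (σ-fixpoint-free g) (g≢g' ∘ sym) fσg≡fg')
    ...   | yes refl = λ _ fσσg≡fg →
      ¬free' (collision⇒free (σ²-fixpoint-free g) (σ-fixpoint-free (σ g)) g≢g' fσσg≡fg)

  v₁-nonadjacent : ∀ {g g'} → g ≢ g' → ¬ E X (g , v₁ g) (g' , v₁ g')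
  v₁-nonadjacent g≢g' (inj₁ (g≡g' , _)) = g≢g' g≡g'
  v₁-nonadjacent g≢g' (inj₂ (_ , v₁g≡fg' , v₁g'≡fg)) = v₁-independent g≢g' v₁g≡fg' v₁g'≡fg

  data Role (g : Fin M) (x : Fin N) : Set where
    first  : x ≡ v₁ g → Role g x
    second : x ≡ v₂ g → Role g x
    other  : x ≢ v₁ g → x ≢ v₂ g → Role g x

  role : ∀ g x → Role g x
  role g x with x ≟ v₁ g | x ≟ v₂ g
  ... | yes x≡v₁ | _ = first x≡v₁
  ... | no _ | yes x≡v₂ = second x≡v₂
  ... | no x≢v₁ | no x≢v₂ = other x≢v₁ x≢v₂

  rank : ∀ {g x} → x ≢ v₁ g → x ≢ v₂ g → Fin (M * n')
  rank {g} x≢v₁ x≢v₂ = combine g (punchOut₂ (v₁≢v₂ g) (x≢v₁ ∘ sym) (x≢v₂ ∘ sym))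

  rank-injective : ∀ {g x g' y} (x≢v₁ : x ≢ v₁ g) (x≢v₂ : x ≢ v₂ g) (y≢v₁ : y ≢ v₁ g') (y≢v₂ : y ≢ v₂ g') →
                   rank x≢v₁ x≢v₂ ≡ rank y≢v₁ y≢v₂ → (g , x) ≡ (g' , y)
  rank-injective {g} {g' = g'} x≢v₁ x≢v₂ y≢v₁ y≢v₂ eq
    with refl ← combine-injectiveˡ g _ g' _ eq =
    cong (g ,_) (punchOut₂-injective (v₁≢v₂ g) (x≢v₁ ∘ sym) (x≢v₂ ∘ sym) (y≢v₁ ∘ sym) (y≢v₂ ∘ sym)
                  (combine-injectiveʳ g _ g _ eq))

  colourOf : ∀ {g x} → Role g x → Fin (2 + M * n')
  colourOf (first _) = zero
  colourOf (second _) = suc zero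
  colourOf (other x≢v₁ x≢v₂) = suc (suc (rank x≢v₁ x≢v₂))

  colour : Fin M × Fin N → Fin (2 + M * n')
  colour (g , x) = colourOf (role g x)

  distinct-copies : ∀ (v : Fin M → Fin N) {g g'} → (g , v g) ≢ (g' , v g') → g ≢ g'
  distinct-copies v u≢v refl = u≢v refl

  colour-packing : IsPackingColoring X (2 + M * n') colour
  colour-packing (g , x) (g' , y) u≢v with role g x | role g' y
  ... | first refl | first refl =
    λ _ → ¬adjacent⇒¬distLe₁ u≢v (v₁-nonadjacent (distinct-copies v₁ u≢v))
  ... | second refl | second refl =
    λ _ → secluded-apart f (v₂-secluded g) (v₂-secluded g') (distinct-copies v₂ u≢v)
  ... | other x≢v₁ x≢v₂ | other y≢v₁ y≢v₂ =
    λ eq _ → u≢v (rank-injective x≢v₁ x≢v₂ y≢v₁ y≢v₂ (suc-injective (suc-injective eq)))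
  ... | first _ | second _ = λ ()
  ... | first _ | other _ _ = λ ()
  ... | second _ | first _ = λ ()
  ... | second _ | other _ _ = λ ()
  ... | other _ _ | first _ = λ ()
  ... | other _ _ | second _ = λ ()

  colouring : HasPackingColoring X (2 + M * n')
  colouring = colour , colour-packing

[m*2+k+2]∸[2*m]≡2+k : ∀ m k → (m * 2 + k + 2) ∸ (2 * m) ≡ 2 + k
[m*2+k+2]∸[2*m]≡2+k m k = trans (cong (_∸ (2 * m)) (rearrange m k)) (m+n∸m≡n (2 * m) (2 + k))
  where
  rearrange : ∀ m k → m * 2 + k + 2 ≡ 2 * m + (2 + k)
  rearrange = solve-∀

lower-bound : ∀ {m n} (f : Fin m → Fin n) → 1 ≤ m → 2 ≤ n →
              ∀ k → HasPackingColoring (Sierpinski (K m) (K n) f) k → (m * n + 2) ∸ (2 * m) ≤ k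
lower-bound f (s≤s z≤n) (s≤s (s≤s z≤n)) k colouring
  with edge⇒two≤colours {u = zero , zero} {v = zero , suc zero} (λ ()) (inj₁ (refl , λ ())) colouring
lower-bound {m} {n} f _ _ (suc (suc k)) colouring | s≤s (s≤s _) = begin
  (m * n + 2) ∸ (2 * m)      ≤⟨ ∸-monoˡ-≤ (2 * m) (+-monoˡ-≤ 2 (packing⇒m*n≤m*2+k f colouring)) ⟩
  (m * 2 + k + 2) ∸ (2 * m)  ≡⟨ [m*2+k+2]∸[2*m]≡2+k m k ⟩
  2 + k                      ∎
  where open ≤-Reasoning

upper-bound : ∀ {m n} (f : Fin m → Fin n) → 3 ≤ m → m ≤ n →
              HasPackingColoring (Sierpinski (K m) (K n) f) ((m * n + 2) ∸ (2 * m))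
upper-bound {m} {suc (suc n')} f (s≤s (s≤s (s≤s z≤n))) m≤n@(s≤s (s≤s _)) =
  subst (HasPackingColoring _) (sym colours) (UpperBound.colouring f m≤n)
  where
  colours : (m * (2 + n') + 2) ∸ (2 * m) ≡ 2 + m * n'
  colours = trans (cong (λ t → (t + 2) ∸ (2 * m)) (*-distribˡ-+ m 2 n')) ([m*2+k+2]∸[2*m]≡2+k m (m * n'))

lemma3p3 : (m n : ℕ) → 3 ≤ m → 3 ≤ n → (f : Fin m → Fin n) →
    ((k : ℕ) → HasPackingColoring (Sierpinski (K m) (K n) f) k →
      (m * n + 2) ∸ (2 * m) ≤ k)
    × (m ≤ n → IsPackingChromaticNumber (Sierpinski (K m) (K n) f) ((m * n + 2) ∸ (2 * m)))
lemma3p3 m n 3≤m 3≤n f = lower , λ m≤n → upper-bound f 3≤m m≤n , lower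
  where
  lower : ∀ k → HasPackingColoring (Sierpinski (K m) (K n) f) k → (m * n + 2) ∸ (2 * m) ≤ k
  lower = lower-bound f (≤-trans (s≤s z≤n) 3≤m) (≤-trans (s≤s (s≤s z≤n)) 3≤n)
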